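{- During the execution of algorithm $\mathcal{D}^2\mathcal{I}$ on any input permutation, at every step we have $Top(D_1)<Top(I)$.
   Context: The $\mathfrak{D}^2\mathfrak{I}$ machine: stacks $D_1,D_2$ (elements in decreasing order from top to bottom, top largest) followed by stack $I$ (elements in increasing order from top to bottom, top smallest). Operations: $d_0$: push next input element into $D_1$; $d_1$: pop $D_1$, push into $D_2$; $d_2$: pop $D_2$, push into $I$; $d_3$: pop $I$ and append to the output. An operation is legal if it respects the stack order restrictions. $Top(X)$ is the top element of stack $X$, and $Input$ is the next element of the input; any statement about an empty stack is considered true. Algorithm $\mathcal{D}^2\mathcal{I}$ repeatedly executes the first applicable instruction among: (1) if $Top(I)$ is the next element to be output, perform $d_3$; (2) if all elements contained in $D_1$ and $D_2$ are the next elements to be output, move them to the output; (3) perform $d_1$, provided $(\beta)$ holds; (4) perform $d_0$, provided $(\gamma)$ holds; (5) perform $d_2$, provided $(\alpha)$ holds; (6) otherwise perform $d_3$. Here $(\alpha)$: $Top(D_2)<Top(I)$; $(\beta)$: $Top(D_2)<Top(D_1)$ and $Top(D_1)<Top(I)$; $(\gamma)$: $Top(D_1)<Input$, $Input<Top(I)$, and the sequence of input elements from $Input$ up to the first input element larger than $Top(D_2)$ is increasing. Operations are only performed when legal. -}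

module Defs where

open import Data.Nat using (ℕ; zero; suc; _+_; _<_; _<ᵇ_; _≡ᵇ_)
open import Data.Bool using (Bool; true; false; _∧_; _∨_; not; if_then_else_)
open import Data.List using (List; []; _∷_; _++_; length; applyUpTo)
open import Data.Maybe using (Maybe; just; nothing)
open import Data.Unit using (⊤)

-- Configuration of the D²I machine.  Stacks are lists with the top first.
record State : Set where
  constructor st
  field
    input : List ℕ   -- remaining input, next element first
    D1    : List ℕ
    D2    : List ℕ
    I     : List ℕ
    out   : List ℕ

open State public

TopLt : List ℕ → List ℕ → Set
TopLt []      _       = ⊤
TopLt (_ ∷ _) []      = ⊤
TopLt (x ∷ _) (y ∷ _) = x < y

topLt : List ℕ → List ℕ → Bool
topLt []      _       = true
topLt (_ ∷ _) []      = true
topLt (x ∷ _) (y ∷ _) = x <ᵇ y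

allᵇ : (ℕ → Bool) → List ℕ → Bool
allᵇ p []       = true
allᵇ p (x ∷ xs) = p x ∧ allᵇ p xs

elemᵇ : ℕ → List ℕ → Bool
elemᵇ x []       = false
elemᵇ x (y ∷ ys) = (x ≡ᵇ y) ∨ elemᵇ x ys

-- Input permutation of 1..n is sorted to 1,2,...,n; the next element to
-- be output is (number of elements already output) + 1.
nextOut : State → ℕ
nextOut s = suc (length (out s))

upToFirstLarger : ℕ → List ℕ → List ℕ
upToFirstLarger t []       = []
upToFirstLarger t (x ∷ xs) = if t <ᵇ x then x ∷ [] else x ∷ upToFirstLarger t xs

increasingᵇ : List ℕ → Bool
increasingᵇ []           = true
increasingᵇ (x ∷ [])     = true
increasingᵇ (x ∷ y ∷ ys) = (x <ᵇ y) ∧ increasingᵇ (y ∷ ys)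

condα : State → Bool
condα s = topLt (D2 s) (I s)

condβ : State → Bool
condβ s = topLt (D2 s) (D1 s) ∧ topLt (D1 s) (I s)

-- Condition (γ): Top(D1) < Input, Input < Top(I), and the input from Input
-- up to the first element larger than Top(D2) is increasing
-- (the last clause is vacuously true when D2 is empty).
runCond : List ℕ → List ℕ → Bool
runCond []      inp = true
runCond (t ∷ _) inp = increasingᵇ (upToFirstLarger t inp)

condγ : State → Bool
condγ s = topLt (D1 s) (input s) ∧ topLt (input s) (I s) ∧ runCond (D2 s) (input s)

-- Rule (2): D1 ∪ D2 is nonempty and consists exactly of the next
-- m = |D1|+|D2| elements to be output, i.e. nextOut, …, nextOut + m - 1
-- (elements are distinct, so this membership check is exact).
block : State → List ℕ
block s = applyUpTo (λ i → nextOut s + i) (length (D1 s ++ D2 s))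

rule2ᵇ : State → Bool
rule2ᵇ s with D1 s ++ D2 s
... | []    = false
... | _ ∷ _ = allᵇ (λ y → elemᵇ y (D1 s ++ D2 s)) (block s)

rule1ᵇ : State → Bool
rule1ᵇ s with I s
... | []    = false
... | x ∷ _ = x ≡ᵇ nextOut s

opd0 opd1 opd2 opd3 : State → Maybe State
opd0 (st []       d1 d2 i o) = nothing
opd0 (st (x ∷ xs) d1 d2 i o) = just (st xs (x ∷ d1) d2 i o)
opd1 (st inp []       d2 i o) = nothing
opd1 (st inp (x ∷ d1) d2 i o) = just (st inp d1 (x ∷ d2) i o)
opd2 (st inp d1 []       i o) = nothing
opd2 (st inp d1 (x ∷ d2) i o) = just (st inp d1 d2 (x ∷ i) o)
opd3 (st inp d1 d2 []      o) = nothing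
opd3 (st inp d1 d2 (x ∷ i) o) = just (st inp d1 d2 i (o ++ x ∷ []))

-- Rule (2): move all of D1, D2 to the output (in increasing order).
moveAll : State → State
moveAll s = st (input s) [] [] (I s) (out s ++ block s)

isNonEmpty : List ℕ → Bool
isNonEmpty []      = false
isNonEmpty (_ ∷ _) = true

-- One step of algorithm D²I: the first applicable (and legal) instruction.
-- nothing = no instruction applicable, the algorithm halts.
step : State → Maybe State
step s =
  if rule1ᵇ s then opd3 s else
  if rule2ᵇ s then just (moveAll s) else
  if isNonEmpty (D1 s) ∧ condβ s then opd1 s else
  if isNonEmpty (input s) ∧ condγ s then opd0 s else
  if isNonEmpty (D2 s) ∧ condα s then opd2 s else
  opd3 s

run : ℕ → State → State
run zero    s = s
run (suc k) s with step s
... | nothing = s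
... | just s' = run k s'

initial : List ℕ → State
initial π = st π [] [] [] []

-- We show that a
-- configuration satisfies
--   (distinct)  the elements of Input, D1, D2 and I are pairwise distinct,
--   (ordered)   D1 is decreasing, I is increasing and Top(D1) < Top(I),
-- initially, and that both properties survive every step.  Distinctness is preserved because each move
-- either permutes the stored elements or discards some of them; order is
-- preserved by comparisons through intermediate tops, and for d2 the
-- failure of (β) together with distinctness forces Top(D1) < Top(D2).
module Submission where

open import Defs
open import Data.Nat using (ℕ; zero; suc)
open import Data.Nat.Properties using (<ᵇ⇒<; <⇒<ᵇ; <-trans; ≮⇒≥; ≤∧≢⇒<; <⇒≢; suc-injective)
open import Data.List using (List; []; _∷_; _++_; [_]; applyUpTo)
open import Data.List.Properties using (++-identityʳ)
open import Data.List.Relation.Binary.Permutation.Propositional using (_↭_; ↭-sym; ↭⇒↭ₛ)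
open import Data.List.Relation.Binary.Permutation.Propositional.Properties using (shift; ++⁺ˡ)
import Data.List.Relation.Binary.Permutation.Setoid.Properties as PermutationSetoid
open import Data.List.Relation.Binary.Sublist.Propositional using (_⊆_; []; _∷_; _∷ʳ_; ⊆-refl; minimum)
open import Data.List.Relation.Binary.Sublist.Propositional.Properties using (All-resp-⊆; ++⁺)
import Data.List.Relation.Binary.Sublist.Propositional.Properties as Sublist
open import Data.List.Relation.Unary.All using ([]; _∷_)
open import Data.List.Relation.Unary.AllPairs using (AllPairs; []; _∷_)
open import Data.List.Relation.Unary.Unique.Propositional using (Unique)
open import Data.List.Relation.Unary.Unique.Propositional.Properties using (applyUpTo⁺₁)
open import Data.Bool using (true; false; _∧_; T)
open import Data.Bool.Properties using (T-≡; T-∧)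
open import Data.Maybe using (just; nothing)
open import Data.Maybe.Properties using (just-injective)
open import Data.Unit using (⊤; tt)
open import Data.Empty using (⊥)
open import Data.Product using (_×_; _,_; proj₂)
open import Function.Bundles using (Equivalence)
open import Relation.Binary.PropositionalEquality using (_≡_; _≢_; refl; sym; subst; setoid)
open import Relation.Nullary using (¬_)

open Equivalence using (to; from)

topLt-sound : ∀ a b → T (topLt a b) → TopLt a b
topLt-sound []      _       _ = tt
topLt-sound (_ ∷ _) []      _ = tt
topLt-sound (x ∷ _) (y ∷ _) t = <ᵇ⇒< x y t

topLt-complete : ∀ a b → TopLt a b → T (topLt a b)
topLt-complete []      _       _   = tt
topLt-complete (_ ∷ _) []      _   = tt
topLt-complete (x ∷ _) (y ∷ _) x<y = <⇒<ᵇ x<y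

retopˡ : ∀ x a b c → TopLt (x ∷ a) c → TopLt (x ∷ b) c
retopˡ x a b []      _ = tt
retopˡ x a b (_ ∷ _) p = p

retopʳ : ∀ a x b c → TopLt a (x ∷ b) → TopLt a (x ∷ c)
retopʳ []      x b c _ = tt
retopʳ (_ ∷ _) x b c p = p

topLt-trans : ∀ a x b c d → TopLt a (x ∷ b) → TopLt (x ∷ c) d → TopLt a d
topLt-trans []      x b c d       _ _ = tt
topLt-trans (_ ∷ _) x b c []      _ _ = tt
topLt-trans (_ ∷ _) x b c (_ ∷ _) p q = <-trans p q

Decreasing : List ℕ → Set
Decreasing []       = ⊤
Decreasing (x ∷ xs) = TopLt xs [ x ] × Decreasing xs

Increasing : List ℕ → Set
Increasing []       = ⊤
Increasing (x ∷ xs) = TopLt [ x ] xs × Increasing xs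

AllPairs-resp-⊆ : ∀ {R : ℕ → ℕ → Set} {xs ys} → xs ⊆ ys → AllPairs R ys → AllPairs R xs
AllPairs-resp-⊆ []         []         = []
AllPairs-resp-⊆ (_ ∷ʳ p)   (_ ∷ rys)  = AllPairs-resp-⊆ p rys
AllPairs-resp-⊆ (refl ∷ p) (ry ∷ rys) = All-resp-⊆ p ry ∷ AllPairs-resp-⊆ p rys

Unique-resp-↭ : ∀ {xs ys : List ℕ} → xs ↭ ys → Unique xs → Unique ys
Unique-resp-↭ p = PermutationSetoid.Unique-resp-↭ (setoid ℕ) (↭⇒↭ₛ p)

contents : State → List ℕ
contents s = input s ++ D1 s ++ D2 s ++ I s

Distinct : State → Set
Distinct s = Unique (contents s)

distinct-apart : ∀ (as : List ℕ) x bs y cs → Unique (as ++ x ∷ bs ++ y ∷ cs) → x ≢ y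
distinct-apart as x bs y cs u = pair-distinct (AllPairs-resp-⊆ pair⊆ u)
  where
    pair⊆ : x ∷ y ∷ [] ⊆ as ++ x ∷ bs ++ y ∷ cs
    pair⊆ = Sublist.++⁺ˡ as (refl ∷ Sublist.++⁺ˡ bs (refl ∷ minimum cs))
    pair-distinct : Unique (x ∷ y ∷ []) → x ≢ y
    pair-distinct ((x≢y ∷ []) ∷ _) = x≢y

Beta : List ℕ → List ℕ → List ℕ → Set
Beta []       _  _ = ⊥
Beta (x ∷ d1) d2 i = TopLt d2 (x ∷ d1) × TopLt (x ∷ d1) i

beta-complete : ∀ d1 d2 i → Beta d1 d2 i → T (isNonEmpty d1 ∧ (topLt d2 d1 ∧ topLt d1 i))
beta-complete (x ∷ d1) d2 i (d2<d1 , d1<i) =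
  from T-∧ (topLt-complete d2 (x ∷ d1) d2<d1 , topLt-complete (x ∷ d1) i d1<i)

-- Step s s': the algorithm may go from s to s', by one of its five moves;
-- each move records the guard facts that the invariant needs.
data Step : State → State → Set where
  push-D1    : ∀ {x inp d1 d2 i o} → TopLt d1 (x ∷ inp) → TopLt (x ∷ inp) i →
               Step (st (x ∷ inp) d1 d2 i o) (st inp (x ∷ d1) d2 i o)
  move-D1-D2 : ∀ {inp x d1 d2 i o} →
               Step (st inp (x ∷ d1) d2 i o) (st inp d1 (x ∷ d2) i o)
  move-D2-I  : ∀ {inp d1 y d2 i o} → ¬ Beta d1 (y ∷ d2) i → TopLt (y ∷ d2) i →
               Step (st inp d1 (y ∷ d2) i o) (st inp d1 d2 (y ∷ i) o)
  pop-I      : ∀ {inp d1 d2 x i o} →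
               Step (st inp d1 d2 (x ∷ i) o) (st inp d1 d2 i (o ++ [ x ]))
  flush      : ∀ {s} → Step s (moveAll s)

by-push-D1 : ∀ s {s'} → T (isNonEmpty (input s) ∧ condγ s) → opd0 s ≡ just s' → Step s s'
by-push-D1 (st []        d1 d2 i o) _ ()
by-push-D1 (st (x ∷ inp) d1 d2 i o) γ refl with to T-∧ γ
... | d1<x , rest with to T-∧ rest
... | x<i , _ = push-D1 (topLt-sound d1 (x ∷ inp) d1<x) (topLt-sound (x ∷ inp) i x<i)

by-move-D1-D2 : ∀ s {s'} → opd1 s ≡ just s' → Step s s'
by-move-D1-D2 (st inp []      d2 i o) ()
by-move-D1-D2 (st inp (_ ∷ _) d2 i o) refl = move-D1-D2

by-move-D2-I : ∀ s {s'} → ¬ T (isNonEmpty (D1 s) ∧ condβ s) → T (isNonEmpty (D2 s) ∧ condα s) →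
               opd2 s ≡ just s' → Step s s'
by-move-D2-I (st inp d1 []       i o) _  _ ()
by-move-D2-I (st inp d1 (y ∷ d2) i o) ¬β α refl =
  move-D2-I (λ β → ¬β (beta-complete d1 (y ∷ d2) i β)) (topLt-sound (y ∷ d2) i α)

by-pop-I : ∀ s {s'} → opd3 s ≡ just s' → Step s s'
by-pop-I (st inp d1 d2 []      o) ()
by-pop-I (st inp d1 d2 (_ ∷ _) o) refl = pop-I

step-cases : ∀ s {s'} → step s ≡ just s' → Step s s'
step-cases s eq with rule1ᵇ s
... | true = by-pop-I s eq
... | false with rule2ᵇ s
... | true = subst (Step s) (just-injective eq) flush
... | false with isNonEmpty (D1 s) ∧ condβ s in eβ
... | true = by-move-D1-D2 s eq
... | false with isNonEmpty (input s) ∧ condγ s in eγ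
... | true = by-push-D1 s (from T-≡ eγ) eq
... | false with isNonEmpty (D2 s) ∧ condα s in eα
... | true = by-move-D2-I s (subst T eβ) (from T-≡ eα) eq
... | false = by-pop-I s eq

run-invariant : (P : State → Set) → (∀ {s s'} → Step s s' → P s → P s') →
                ∀ k s → P s → P (run k s)
run-invariant P preserved zero    s ps = ps
run-invariant P preserved (suc k) s ps with step s in e
... | nothing = ps
... | just s' = run-invariant P preserved k s' (preserved (step-cases s e) ps)

-- Each move permutes the stored elements or discards some of them.
distinct-step : ∀ {s s'} → Step s s' → Distinct s → Distinct s'
distinct-step (push-D1 {x} {inp} {d1} {d2} {i} _ _) =
  Unique-resp-↭ (↭-sym (shift x inp (d1 ++ d2 ++ i)))
distinct-step (move-D1-D2 {inp} {x} {d1} {d2} {i}) =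
  Unique-resp-↭ (++⁺ˡ inp (↭-sym (shift x d1 (d2 ++ i))))
distinct-step (move-D2-I {inp} {d1} {y} {d2} {i} _ _) =
  Unique-resp-↭ (++⁺ˡ inp (++⁺ˡ d1 (↭-sym (shift y d2 i))))
distinct-step (pop-I {inp} {d1} {d2} {x} {i}) =
  AllPairs-resp-⊆ (++⁺ (⊆-refl {x = inp}) (++⁺ (⊆-refl {x = d1}) (++⁺ (⊆-refl {x = d2}) (x ∷ʳ ⊆-refl))))
distinct-step (flush {st inp d1 d2 i o}) =
  AllPairs-resp-⊆ (++⁺ (⊆-refl {x = inp}) (Sublist.++⁺ˡ d1 (Sublist.++⁺ˡ d2 ⊆-refl)))

record Ordered (s : State) : Set where
  constructor ordered
  field
    D1-decreasing : Decreasing (D1 s)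
    I-increasing  : Increasing (I s)
    D1<I          : TopLt (D1 s) (I s)

-- Key step for d2: if (β) fails although Top(D1) < Top(I), then
-- Top(D1) ≤ Top(D2), hence Top(D1) < Top(D2) as the two are distinct.
D1-below-D2 : ∀ inp d1 y d2 i → Unique (inp ++ d1 ++ y ∷ d2 ++ i) →
              ¬ Beta d1 (y ∷ d2) i → TopLt d1 i → TopLt d1 (y ∷ i)
D1-below-D2 inp []       y d2 i _ _  _   = tt
D1-below-D2 inp (x ∷ d1) y d2 i u ¬β x<i =
  ≤∧≢⇒< (≮⇒≥ (λ y<x → ¬β (y<x , x<i))) (distinct-apart inp x d1 y (d2 ++ i) u)

ordered-step : ∀ {s s'} → Step s s' → Distinct s → Ordered s → Ordered s'
ordered-step (push-D1 {x} {inp} {d1} {d2} {i} d1<x x<i) _ (ordered dec inc _) =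
  ordered (retopʳ d1 x inp [] d1<x , dec) inc (retopˡ x inp d1 i x<i)
ordered-step (move-D1-D2 {x = x} {d1} {i = i}) _ (ordered (d1<x , dec) inc x<i) =
  ordered dec inc (topLt-trans d1 x [] d1 i d1<x x<i)
ordered-step (move-D2-I {inp} {d1} {y} {d2} {i} ¬β y<i) u (ordered dec inc d1<i) =
  ordered dec (retopˡ y d2 [] i y<i , inc) (D1-below-D2 inp d1 y d2 i u ¬β d1<i)
ordered-step (pop-I {d1 = d1} {x = x} {i}) _ (ordered dec (x<i , inc) d1<x) =
  ordered dec inc (topLt-trans d1 x i [] i d1<x x<i)
ordered-step flush _ (ordered _ inc _) = ordered tt inc tt

-- Ordering is preserved only in the presence of distinctness (move d2).
Invariant : State → Set
Invariant s = Distinct s × Ordered s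

invariant-step : ∀ {s s'} → Step s s' → Invariant s → Invariant s'
invariant-step mv (u , ord) = distinct-step mv u , ordered-step mv u ord

invariant-initial : ∀ n π → π ↭ applyUpTo suc n → Invariant (initial π)
invariant-initial n π π↭ = subst Unique (sym (++-identityʳ π)) (Unique-resp-↭ (↭-sym π↭) upTo-unique)
                         , ordered tt tt tt
  where
    upTo-unique : Unique (applyUpTo suc n)
    upTo-unique = applyUpTo⁺₁ suc n (λ i<j _ eq → <⇒≢ i<j (suc-injective eq))

lemma4 : (n : ℕ) (π : List ℕ) → π ↭ applyUpTo suc n →
    (k : ℕ) → TopLt (D1 (run k (initial π))) (I (run k (initial π)))
lemma4 n π π↭ k =
  Ordered.D1<I (proj₂ (run-invariant Invariant invariant-step k (initial π) (invariant-initial n π π↭)))
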